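{- Let $0<\alpha<1$ be irrational with continued fraction $[0,a_1,a_2,\ldots]$ and convergent denominators $q_i$ (with $q_{ -1}=0$). Let $t\ge0$ and let $n\ge1$ satisfy $q_t+q_{t-1}-1 \leq n \leq q_{t+1}+q_t-2$. Then the smallest period of the length-$n$ prefix $Y_n$ of the characteristic Sturmian word $\mathbf{x}_\alpha$ is at least $q_t$.
   Context: Let $p_i/q_i=[0,a_1,\ldots,a_i]$ be the convergents of $\alpha$, so $q_{ -1}=0$, $q_0=1$, $q_i=a_iq_{i-1}+q_{i-2}$ for $i\ge1$. The characteristic Sturmian word $\mathbf{x}_\alpha=x_1x_2\cdots$ is given by $x_i=\lfloor (i+1)\alpha\rfloor-\lfloor i\alpha\rfloor$, $i\ge1$. An integer $p$ with $1\le p\le |w|$ is a period of a finite word $w$ if $w[i]=w[i+p]$ for all $1\le i\le |w|-p$. -}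

module Defs where

open import Data.Nat using (ℕ; zero; suc; _+_; _*_; _∸_; _≤_; _/_)

-- A continued-fraction digit sequence: a i is the digit a_i (i ≥ 1);
-- a 0 is unused (α = [0; a_1, a_2, ...] with 0 < α < 1).
-- Every irrational α ∈ (0,1) corresponds to exactly one sequence with a_i ≥ 1 for i ≥ 1.

-- Index-shifted convergent denominators:  qq j = q_{j-1}.
-- qq 0 = q_{-1} = 0, qq 1 = q_0 = 1, q_i = a_i q_{i-1} + q_{i-2}.
qq : (ℕ → ℕ) → ℕ → ℕ
qq a zero = 0
qq a (suc zero) = 1
qq a (suc (suc j)) = a (suc j) * qq a (suc j) + qq a j

-- Index-shifted convergent numerators:  pp j = p_{j-1}.
-- pp 0 = p_{-1} = 1, pp 1 = p_0 = 0, p_i = a_i p_{i-1} + p_{i-2}.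
pp : (ℕ → ℕ) → ℕ → ℕ
pp a zero = 1
pp a (suc zero) = 0
pp a (suc (suc j)) = a (suc j) * pp a (suc j) + pp a j

-- floor division, with the (never used) convention m /' 0 = 0
_/'_ : ℕ → ℕ → ℕ
m /' zero = 0
m /' suc d = m / suc d

-- ⌊ i α ⌋, computed exactly from the digits: ⌊ i α ⌋ = ⌊ i p_k / q_k ⌋ for the
-- even index k = 2i.
floorMul : (ℕ → ℕ) → ℕ → ℕ
floorMul a i = (i * pp a (suc (2 * i))) /' qq a (suc (2 * i))

sturm : (ℕ → ℕ) → ℕ → ℕ
sturm a i = floorMul a (suc i) ∸ floorMul a i

IsPeriod : (ℕ → ℕ) → ℕ → ℕ → Set
IsPeriod w n p = 1 ≤ p × p ≤ n × (∀ i → 1 ≤ i → i + p ≤ n → w i ≡ w (i + p))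
  where
  open import Data.Product using (_×_)
  open import Relation.Binary.PropositionalEquality using (_≡_)

module Submission where

-- For 1 ≤ i < q_t + q_{t+1} no fraction m/i lies strictly between the consecutive convergents
-- p_t/q_t and p_{t+1}/q_{t+1}, so p_t/q_t alone decides whether m/i < α; on [q_{t-1}, q_{t-1} + q_t]
-- the function i ↦ ⌊iα⌋ is therefore ⌊i p_t/q_t⌋ or ⌈i p_t/q_t⌉ − 1, according to the side of α on
-- which p_t/q_t lies.  A period p < q_t of the prefix makes the increments x_i of ⌊iα⌋ p-periodic
-- there, and telescoping gives, with q' = q_{t-1},
--   ⌊(q' + q_t)α⌋ + ⌊q'α⌋ = ⌊(q' + p)α⌋ + ⌊(q' + q_t − p)α⌋.
-- As q' p_t ≡ ±1 (mod q_t), the floor bounds at q' and q' + q_t are attained with equality; the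
-- four bounds then add up to an equality, so the bound at q' + p is attained too, i.e.
-- (q' + p) p_t ≡ q' p_t (mod q_t).  Since p_t and q_t are coprime, q_t ∣ p.

open import Defs
open import Data.Nat
  using (ℕ; zero; suc; _+_; _*_; _∸_; _≤_; _<_; _≤′_; ≤′-refl; ≤′-step; s≤s; s≤s⁻¹; z≤n;
         NonZero; >-nonZero)
open import Data.Nat.Properties
open import Algebra.Properties.CommutativeSemigroup +-commutativeSemigroup
  using (xy∙z≈xz∙y; interchange)
open import Data.Nat.DivMod using (_/_; m/n*n≤m; /-monoˡ-≤; m*n/n≡m)
open import Data.Nat.Divisibility
  using (_∣_; ∣⇒≤; ∣1⇒≡1; ∣m+n∣m⇒∣n; ∣m⇒∣m*n; ∣n⇒∣m*n; n∣m*n)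
open import Data.Nat.Coprimality using (Coprime; coprime-divisor)
open import Data.Nat.Tactic.RingSolver using (solve; solve-∀)
open import Data.List.Base using (_∷_; [])
open import Data.Product using (_×_; _,_; proj₁; proj₂)
open import Data.Sum using ([_,_]′)
open import Function.Base using (id)
open import Function.Bundles using (_⇔_; mk⇔; Equivalence)
open import Function.Construct.Composition using (_⇔-∘_)
open import Function.Construct.Symmetry using (⇔-sym)
open import Function.Construct.Identity using (⇔-id)
open import Relation.Nullary using (¬_)
open import Relation.Binary.PropositionalEquality
  using (_≡_; refl; sym; trans; cong; cong₂; subst; module ≡-Reasoning)

open Equivalence using (to; from)

Adjacent : (P Q P' Q' : ℕ) → Set
Adjacent P Q P' Q' = P' * Q ≡ P * Q' + 1

-- m/i ≤ P/Q ⇔ m/i < P'/Q': no fraction with denominator below Q + Q' lies in (P/Q, P'/Q')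
adjacent-gap : ∀ {P Q P' Q' m i} → Adjacent P Q P' Q' → 1 ≤ i → i < Q + Q' →
               m * Q ≤ i * P ⇔ m * Q' < i * P'
adjacent-gap {P} {Q} {P'} {Q'} {m} {i} adj 1≤i i<Q+Q' = mk⇔ left⇒right right⇒left
  where
  open ≤-Reasoning

  scaled-adj : i * P' * Q ≡ i * P * Q' + i
  scaled-adj = begin-equality
    i * P' * Q       ≡⟨ *-assoc i P' Q ⟩
    i * (P' * Q)     ≡⟨ cong (i *_) adj ⟩
    i * (P * Q' + 1) ≡⟨ solve (i ∷ P ∷ Q' ∷ []) ⟩
    i * P * Q' + i   ∎

  left⇒right : m * Q ≤ i * P → m * Q' < i * P'
  left⇒right mQ≤iP = *-cancelʳ-< Q (m * Q') (i * P') (begin-strict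
    m * Q' * Q     ≡⟨ solve (m ∷ Q' ∷ Q ∷ []) ⟩
    m * Q * Q'     ≤⟨ *-monoˡ-≤ Q' mQ≤iP ⟩
    i * P * Q'     <⟨ m<m+n (i * P * Q') 1≤i ⟩
    i * P * Q' + i ≡⟨ scaled-adj ⟨
    i * P' * Q     ∎)

  right⇒left : m * Q' < i * P' → m * Q ≤ i * P
  right⇒left mQ'<iP' = ≮⇒≥ λ iP<mQ → <⇒≱ i<Q+Q' (Q+Q'≤i iP<mQ)
    where
    -- i = i (P'Q − PQ') = Q (iP' − mQ') + Q' (mQ − iP), and both brackets would be positive
    Q+Q'≤i : i * P < m * Q → Q + Q' ≤ i
    Q+Q'≤i iP<mQ = +-cancelʳ-≤ (Q * (m * Q') + Q' * (i * P)) (Q + Q') i (begin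
      Q + Q' + (Q * (m * Q') + Q' * (i * P)) ≡⟨ solve (Q ∷ Q' ∷ m ∷ i ∷ P ∷ []) ⟩
      Q * suc (m * Q') + Q' * suc (i * P)    ≤⟨ +-mono-≤ (*-monoʳ-≤ Q mQ'<iP') (*-monoʳ-≤ Q' iP<mQ) ⟩
      Q * (i * P') + Q' * (m * Q)            ≡⟨ solve (Q ∷ Q' ∷ m ∷ i ∷ P' ∷ []) ⟩
      i * P' * Q + m * Q * Q'                ≡⟨ cong (_+ m * Q * Q') scaled-adj ⟩
      i * P * Q' + i + m * Q * Q'            ≡⟨ solve (Q ∷ Q' ∷ m ∷ i ∷ P ∷ []) ⟩
      i + (Q * (m * Q') + Q' * (i * P))      ∎)

adjacent-coprime : ∀ {P Q P' Q'} → Adjacent P Q P' Q' → Coprime Q P × Coprime Q' P'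
adjacent-coprime {P} {Q} {P'} {Q'} adj =
    (λ (d∣Q , d∣P) → divides-1 (∣n⇒∣m*n P' d∣Q) (∣m⇒∣m*n Q' d∣P))
  , (λ (d∣Q' , d∣P') → divides-1 (∣m⇒∣m*n Q d∣P') (∣n⇒∣m*n P d∣Q'))
  where
  divides-1 : ∀ {d} → d ∣ P' * Q → d ∣ P * Q' → d ≡ 1
  divides-1 {d} d∣P'Q d∣PQ' = ∣1⇒≡1 (∣m+n∣m⇒∣n (subst (d ∣_) adj d∣P'Q) d∣PQ')

adjacent-extendˡ : ∀ c {P Q P' Q'} → Adjacent P Q P' Q' → Adjacent (c * P' + P) (c * Q' + Q) P' Q'
adjacent-extendˡ c {P} {Q} {P'} {Q'} adj = begin
  P' * (c * Q' + Q)          ≡⟨ solve (c ∷ Q ∷ P' ∷ Q' ∷ []) ⟩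
  c * P' * Q' + P' * Q       ≡⟨ cong (c * P' * Q' +_) adj ⟩
  c * P' * Q' + (P * Q' + 1) ≡⟨ solve (c ∷ P ∷ P' ∷ Q' ∷ []) ⟩
  (c * P' + P) * Q' + 1      ∎
  where open ≡-Reasoning

adjacent-extendʳ : ∀ c {P Q P' Q'} → Adjacent P Q P' Q' → Adjacent P Q (c * P + P') (c * Q + Q')
adjacent-extendʳ c {P} {Q} {P'} {Q'} adj = begin
  (c * P + P') * Q         ≡⟨ solve (c ∷ P ∷ Q ∷ P' ∷ []) ⟩
  c * P * Q + P' * Q       ≡⟨ cong (c * P * Q +_) adj ⟩
  c * P * Q + (P * Q' + 1) ≡⟨ solve (c ∷ P ∷ Q ∷ Q' ∷ []) ⟩
  P * (c * Q + Q') + 1     ∎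
  where open ≡-Reasoning

data Side : Set where
  upper lower : Side

opposite : Side → Side
opposite upper = lower
opposite lower = upper

-- pp a j / qq a j is p_{j-1}/q_{j-1}, hence above α for even j (j = 0 gives 1/0)
side : ℕ → Side
side zero    = upper
side (suc j) = opposite (side j)

side-even : ∀ i → side (2 * i) ≡ upper
side-even zero    = refl
side-even (suc i) rewrite +-suc i (i + 0) | side-even i = refl

-- m/i < α, read off a fraction P/Q lying on the given side of α
Below : Side → (P Q m i : ℕ) → Set
Below upper P Q m i = m * Q < i * P
Below lower P Q m i = m * Q ≤ i * P

Straddle : Side → (P Q P' Q' : ℕ) → Set
Straddle upper P Q P' Q' = Adjacent P' Q' P Q
Straddle lower P Q P' Q' = Adjacent P Q P' Q'

straddle-extend : ∀ s c {P Q P' Q'} → Straddle s P Q P' Q' →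
                  Straddle (opposite s) P' Q' (c * P' + P) (c * Q' + Q)
straddle-extend upper c = adjacent-extendʳ c
straddle-extend lower c = adjacent-extendˡ c

straddle-Below : ∀ s {P Q P' Q' m i} → Straddle s P Q P' Q' → 1 ≤ i → i < Q + Q' →
                 Below s P Q m i ⇔ Below (opposite s) P' Q' m i
straddle-Below upper {Q = Q} {Q' = Q'} {m} {i} adj 1≤i i<Q+Q' =
  ⇔-sym (adjacent-gap {m = m} adj 1≤i (subst (i <_) (+-comm Q Q') i<Q+Q'))
straddle-Below lower {m = m} adj 1≤i i<Q+Q' = adjacent-gap {m = m} adj 1≤i i<Q+Q'

Below-suc : ∀ s {P Q m i} → Below s P Q m i → Below s P Q m (suc i)
Below-suc upper {P} {i = i} mQ<iP = <-≤-trans mQ<iP (*-monoˡ-≤ P (n≤1+n i))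
Below-suc lower {P} {i = i} mQ≤iP = ≤-trans mQ≤iP (*-monoˡ-≤ P (n≤1+n i))

record IsFloor (s : Side) (P Q i f : ℕ) : Set where
  constructor isFloor
  field
    attained : Below s P Q f i
    maximal  : ¬ Below s P Q (suc f) i

open IsFloor

⇔⇒IsFloor : ∀ {s P Q i f} → (∀ m → m ≤ f ⇔ Below s P Q m i) → IsFloor s P Q i f
⇔⇒IsFloor char = isFloor (to (char _) ≤-refl) (λ below → 1+n≰n (from (char _) below))

module _ {P Q : ℕ} .{{_ : NonZero Q}} where

  IsFloor-upper-exact : ∀ {i f z} → IsFloor upper P Q i f → i * P ≡ suc (z * Q) → f ≡ z
  IsFloor-upper-exact {i} {f} {z} (isFloor fQ<iP ¬sfQ<iP) iP≡1+zQ = ≤-antisym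
    (*-cancelʳ-≤ f z Q (s≤s⁻¹ (subst (f * Q <_) iP≡1+zQ fQ<iP)))
    (s≤s⁻¹ (*-cancelʳ-< Q z (suc f) (subst (_≤ suc f * Q) iP≡1+zQ (≮⇒≥ ¬sfQ<iP))))

  IsFloor-lower-exact : ∀ {i f z} → IsFloor lower P Q i f → suc (i * P) ≡ z * Q → suc f ≡ z
  IsFloor-lower-exact {i} {f} {z} (isFloor fQ≤iP ¬sfQ≤iP) 1+iP≡zQ = ≤-antisym
    (*-cancelʳ-< Q f z (≤-<-trans fQ≤iP (subst (i * P <_) 1+iP≡zQ ≤-refl)))
    (*-cancelʳ-≤ z (suc f) Q (subst (_≤ suc f * Q) 1+iP≡zQ (≰⇒> ¬sfQ≤iP)))

≤/'⇔*≤ : ∀ {m} x Q → 1 ≤ Q → m ≤ x /' Q ⇔ m * Q ≤ x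
≤/'⇔*≤ {m} x (suc Q) _ = mk⇔
  (λ m≤x/Q → ≤-trans (*-monoˡ-≤ (suc Q) m≤x/Q) (m/n*n≤m x (suc Q)))
  (λ mQ≤x → subst (_≤ x / suc Q) (m*n/n≡m m (suc Q)) (/-monoˡ-≤ (suc Q) mQ≤x))

module _ (F x : ℕ → ℕ) (F-suc : ∀ i → F (suc i) ≡ F i + x i) where

  shifted-increments : ∀ b p k → (∀ j → j < k → x (b + j) ≡ x (b + j + p)) →
                       F (b + k + p) + F b ≡ F (b + p) + F (b + k)
  shifted-increments b p zero _ rewrite +-identityʳ b = refl
  shifted-increments b p (suc k) periodic = begin
    F (b + suc k + p) + F b              ≡⟨ cong (λ n → F (n + p) + F b) (+-suc b k) ⟩
    F (suc (b + k + p)) + F b            ≡⟨ cong (_+ F b) (F-suc (b + k + p)) ⟩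
    F (b + k + p) + x (b + k + p) + F b  ≡⟨ xy∙z≈xz∙y (F (b + k + p)) _ (F b) ⟩
    F (b + k + p) + F b + x (b + k + p)  ≡⟨ cong₂ _+_ shorter (sym (periodic k ≤-refl)) ⟩
    F (b + p) + F (b + k) + x (b + k)    ≡⟨ +-assoc (F (b + p)) _ _ ⟩
    F (b + p) + (F (b + k) + x (b + k))  ≡⟨ cong (F (b + p) +_) (sym (F-suc (b + k))) ⟩
    F (b + p) + F (suc (b + k))          ≡⟨ cong (λ n → F (b + p) + F n) (+-suc b k) ⟨
    F (b + p) + F (b + suc k)            ∎
    where
    open ≡-Reasoning
    shorter : F (b + k + p) + F b ≡ F (b + p) + F (b + k)
    shorter = shifted-increments b p k (λ j j<k → periodic j (m<n⇒m<1+n j<k))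

module _ (a : ℕ → ℕ) where

  convergents-straddle : ∀ j → Straddle (side j) (pp a j) (qq a j) (pp a (suc j)) (qq a (suc j))
  convergents-straddle zero    = refl
  convergents-straddle (suc j) = straddle-extend (side j) (a (suc j)) (convergents-straddle j)

  BelowAt : (j m i : ℕ) → Set
  BelowAt j = Below (side j) (pp a j) (qq a j)

  qq-sum-mono : ∀ {j k} → j ≤′ k → qq a j + qq a (suc j) ≤ qq a k + qq a (suc k)
  qq-sum-mono ≤′-refl = ≤-refl
  qq-sum-mono {j} (≤′-step {k} j≤′k) = begin
    qq a j + qq a (suc j)             ≤⟨ qq-sum-mono j≤′k ⟩
    qq a k + qq a (suc k)             ≤⟨ +-monoˡ-≤ _ (m≤n+m (qq a k) _) ⟩
    qq a (suc (suc k)) + qq a (suc k) ≡⟨ +-comm _ (qq a (suc k)) ⟩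
    qq a (suc k) + qq a (suc (suc k)) ∎
    where open ≤-Reasoning

  BelowAt-stable : ∀ {j k m i} → j ≤′ k → 1 ≤ i → i < qq a j + qq a (suc j) →
                   BelowAt j m i ⇔ BelowAt k m i
  BelowAt-stable ≤′-refl _ _ = ⇔-id _
  BelowAt-stable {j} (≤′-step {k} j≤′k) 1≤i i<sum =
    straddle-Below (side k) (convergents-straddle k) 1≤i (<-≤-trans i<sum (qq-sum-mono j≤′k))
      ⇔-∘ BelowAt-stable j≤′k 1≤i i<sum

  BelowAt-agree : ∀ j k {m i} → 1 ≤ i →
                  i < qq a j + qq a (suc j) → i < qq a k + qq a (suc k) →
                  BelowAt j m i ⇔ BelowAt k m i
  BelowAt-agree j k 1≤i i<j-sum i<k-sum =
    [ (λ j≤k → BelowAt-stable (≤⇒≤′ j≤k) 1≤i i<j-sum)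
    , (λ k≤j → ⇔-sym (BelowAt-stable (≤⇒≤′ k≤j) 1≤i i<k-sum))
    ]′ (≤-total j k)

  module _ (a-pos : ∀ i → 1 ≤ i → 1 ≤ a i) where

    qq-pos : ∀ j → 1 ≤ qq a (suc j)
    qq-pos zero    = ≤-refl
    qq-pos (suc j) = ≤-trans (*-mono-≤ (a-pos (suc j) (s≤s z≤n)) (qq-pos j)) (m≤m+n _ (qq a j))

    qq-grows : ∀ j → qq a j < qq a (suc (suc j))
    qq-grows j = m<n+m (qq a j) (*-mono-≤ (a-pos (suc j) (s≤s z≤n)) (qq-pos j))

    <qq-sum : ∀ j → j < qq a j + qq a (suc j)
    <qq-sum zero    = ≤-refl
    <qq-sum (suc j) = begin
      suc (suc j)                        ≤⟨ s≤s (<qq-sum j) ⟩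
      suc (qq a j + qq a (suc j))        ≡⟨ cong suc (+-comm (qq a j) _) ⟩
      suc (qq a (suc j) + qq a j)        ≤⟨ +-monoʳ-< (qq a (suc j)) (qq-grows j) ⟩
      qq a (suc j) + qq a (suc (suc j))  ∎
      where open ≤-Reasoning

    ≤floorMul⇔BelowAt : ∀ {i j m} → 1 ≤ i → i < qq a j + qq a (suc j) →
                        m ≤ floorMul a i ⇔ BelowAt j m i
    ≤floorMul⇔BelowAt {i} {j} {m} 1≤i i<sum =
      BelowAt-agree L j 1≤i i<own-sum i<sum ⇔-∘ at-own-level
      where
      L : ℕ
      L = suc (2 * i)

      i<own-sum : i < qq a L + qq a (suc L)
      i<own-sum = <-≤-trans (s≤s (≤-trans (m≤m+n i (i + 0)) (n≤1+n (2 * i)))) (<qq-sum L)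

      at-own-level : m ≤ floorMul a i ⇔ BelowAt L m i
      at-own-level rewrite side-even i = ≤/'⇔*≤ (i * pp a L) (qq a L) (qq-pos (2 * i))

    floorMul-mono : ∀ i → floorMul a i ≤ floorMul a (suc i)
    floorMul-mono zero    = z≤n
    floorMul-mono (suc i) =
      from (≤floorMul⇔BelowAt (s≤s z≤n) (<qq-sum L))
        (Below-suc (side L) (to (≤floorMul⇔BelowAt (s≤s z≤n) (<⇒≤ (<qq-sum L))) ≤-refl))
      where
      L : ℕ
      L = suc (suc i)

    floorMul-suc : ∀ i → floorMul a (suc i) ≡ floorMul a i + sturm a i
    floorMul-suc i = sym (m+[n∸m]≡n (floorMul-mono i))

    floorMul-IsFloor : ∀ {i j} → 1 ≤ i → i < qq a j + qq a (suc j) →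
                       IsFloor (side j) (pp a j) (qq a j) i (floorMul a i)
    floorMul-IsFloor {j = j} 1≤i i<sum = ⇔⇒IsFloor (λ m → ≤floorMul⇔BelowAt {j = j} 1≤i i<sum)

    floorMul-IsFloor-window : ∀ j {i} → qq a (suc j) ≤ i → i ≤ qq a (suc j) + qq a (suc (suc j)) →
                              IsFloor (side (suc (suc j))) (pp a (suc (suc j))) (qq a (suc (suc j)))
                                      i (floorMul a i)
    floorMul-IsFloor-window j {i} qq≤i i≤sum =
      floorMul-IsFloor (≤-trans (qq-pos j) qq≤i) (begin-strict
        i                                             ≤⟨ i≤sum ⟩
        qq a (suc j) + qq a (suc (suc j))             ≡⟨ +-comm (qq a (suc j)) _ ⟩
        qq a (suc (suc j)) + qq a (suc j)             <⟨ +-monoʳ-< _ (qq-grows (suc j)) ⟩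
        qq a (suc (suc j)) + qq a (suc (suc (suc j))) ∎)
      where open ≤-Reasoning

    period-balances : ∀ {n p} q' Q → 1 ≤ q' → Q + q' ∸ 1 ≤ n → p ≤ Q → IsPeriod (sturm a) n p →
                      floorMul a (q' + Q) + floorMul a q'
                        ≡ floorMul a (q' + p) + floorMul a (q' + (Q ∸ p))
    period-balances {n} {p} q' Q 1≤q' n-large p≤Q (_ , _ , periodic) =
      trans (cong (λ k → floorMul a k + floorMul a q') q'+Q≡q'+[Q∸p]+p)
        (shifted-increments (floorMul a) (sturm a) floorMul-suc q' p (Q ∸ p)
          (λ j j<Q∸p → periodic (q' + j) (≤-trans 1≤q' (m≤m+n q' j)) (in-prefix j j<Q∸p)))
      where
      q'+Q≡q'+[Q∸p]+p : q' + Q ≡ q' + (Q ∸ p) + p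
      q'+Q≡q'+[Q∸p]+p = trans (cong (q' +_) (sym (m∸n+n≡m p≤Q))) (sym (+-assoc q' (Q ∸ p) p))

      in-prefix : ∀ j → j < Q ∸ p → q' + j + p ≤ n
      in-prefix j j<Q∸p = begin
        q' + j + p    ≡⟨ +-assoc q' j p ⟩
        q' + (j + p)  ≤⟨ <⇒≤pred (+-monoʳ-< q' j+p<Q) ⟩
        q' + Q ∸ 1    ≡⟨ cong (_∸ 1) (+-comm q' Q) ⟩
        Q + q' ∸ 1    ≤⟨ n-large ⟩
        n             ∎
        where
        open ≤-Reasoning
        j+p<Q : j + p < Q
        j+p<Q = subst (j + p <_) (m∸n+n≡m p≤Q) (+-monoˡ-< p j<Q∸p)

squeeze : ∀ {a b c d} → a ≤ c → b ≤ d → a + b ≡ c + d → a ≡ c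
squeeze {a} {b} {c} {d} a≤c b≤d a+b≡c+d = ≤-antisym a≤c (+-cancelʳ-≤ d c a (begin
  c + d ≡⟨ a+b≡c+d ⟨
  a + b ≤⟨ +-monoʳ-≤ a b≤d ⟩
  a + d ∎))
  where open ≤-Reasoning

+-both : ∀ x {a b c d} → a + b ≡ c + d → (x + a) + (x + b) ≡ (x + c) + (x + d)
+-both x {a} {b} {c} {d} a+b≡c+d = begin
  (x + a) + (x + b) ≡⟨ interchange x a x b ⟩
  (x + x) + (a + b) ≡⟨ cong ((x + x) +_) a+b≡c+d ⟩
  (x + x) + (c + d) ≡⟨ interchange x c x d ⟨
  (x + c) + (x + d) ∎
  where open ≡-Reasoning

module _ {P Q p' q' : ℕ} .{{_ : NonZero Q}} (F : ℕ → ℕ) {p : ℕ} (p≤Q : p ≤ Q)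
         (balanced : F (q' + Q) + F q' ≡ F (q' + p) + F (q' + (Q ∸ p))) where

  FloorsOn : Side → Set
  FloorsOn s = ∀ {i} → q' ≤ i → i ≤ q' + Q → IsFloor s P Q i (F i)

  private
    q'≤q'+Q : q' ≤ q' + Q
    q'≤q'+Q = m≤m+n q' Q

    q'≤q'+p : q' ≤ q' + p
    q'≤q'+p = m≤m+n q' p

    q'+p≤q'+Q : q' + p ≤ q' + Q
    q'+p≤q'+Q = +-monoʳ-≤ q' p≤Q

    q'≤q'+Q∸p : q' ≤ q' + (Q ∸ p)
    q'≤q'+Q∸p = m≤m+n q' (Q ∸ p)

    q'+Q∸p≤q'+Q : q' + (Q ∸ p) ≤ q' + Q
    q'+Q∸p≤q'+Q = +-monoʳ-≤ q' (m∸n≤m Q p)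

    linear : (q' + Q) * P + q' * P ≡ (q' + p) * P + (q' + (Q ∸ p)) * P
    linear = begin
      (q' + Q) * P + q' * P             ≡⟨ cong (λ n → (q' + n) * P + q' * P) (m∸n+n≡m p≤Q) ⟨
      (q' + (Q ∸ p + p)) * P + q' * P   ≡⟨ swap-parts q' (Q ∸ p) p P ⟩
      (q' + p) * P + (q' + (Q ∸ p)) * P ∎
      where
      open ≡-Reasoning
      swap-parts : ∀ q' r p P → (q' + (r + p)) * P + q' * P ≡ (q' + p) * P + (q' + r) * P
      swap-parts = solve-∀

    A B C D : ℕ
    A = F (q' + p)
    B = F (q' + (Q ∸ p))
    C = F (q' + Q)
    D = F q'

    scaled-balance : C * Q + D * Q ≡ A * Q + B * Q
    scaled-balance = begin
      C * Q + D * Q ≡⟨ *-distribʳ-+ Q C D ⟨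
      (C + D) * Q   ≡⟨ cong (_* Q) balanced ⟩
      (A + B) * Q   ≡⟨ *-distribʳ-+ Q A B ⟩
      A * Q + B * Q ∎
      where open ≡-Reasoning

    Q∣p : Coprime Q P → ∀ x y → y * Q ≡ x * Q + P * p → Q ∣ p
    Q∣p coprime x y yQ≡xQ+Pp =
      coprime-divisor coprime (∣m+n∣m⇒∣n (subst (Q ∣_) yQ≡xQ+Pp (n∣m*n y)) (n∣m*n x))

    split-p : (q' + p) * P ≡ q' * P + P * p
    split-p = trans (*-distribʳ-+ P q' p) (cong (q' * P +_) (*-comm p P))

  balanced⇒∣-upper : Adjacent p' q' P Q → FloorsOn upper → Q ∣ p
  balanced⇒∣-upper adj floor = Q∣p (proj₂ (adjacent-coprime {p'} {q'} adj)) D A (suc-injective (begin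
    suc (A * Q)         ≡⟨ at-q'+p ⟩
    (q' + p) * P        ≡⟨ split-p ⟩
    q' * P + P * p      ≡⟨ cong (_+ P * p) at-q' ⟩
    suc (D * Q + P * p) ∎))
    where
    open ≡-Reasoning

    exact : ∀ {i} → q' ≤ i → i ≤ q' + Q → ∀ z → i * P ≡ suc (z * Q) → i * P ≡ suc (F i * Q)
    exact q'≤i i≤q'+Q z iP≡1+zQ = trans iP≡1+zQ
      (cong (λ n → suc (n * Q)) (sym (IsFloor-upper-exact {z = z} (floor q'≤i i≤q'+Q) iP≡1+zQ)))

    at-q' : q' * P ≡ suc (D * Q)
    at-q' = exact ≤-refl q'≤q'+Q p' (trans (*-comm q' P) (trans adj (+-comm (p' * Q) 1)))

    at-q'+Q : (q' + Q) * P ≡ suc (C * Q)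
    at-q'+Q = exact q'≤q'+Q ≤-refl (p' + P) (begin
      (q' + Q) * P       ≡⟨ solve (q' ∷ Q ∷ P ∷ []) ⟩
      P * q' + P * Q     ≡⟨ cong (_+ P * Q) adj ⟩
      p' * Q + 1 + P * Q ≡⟨ solve (p' ∷ Q ∷ P ∷ []) ⟩
      suc ((p' + P) * Q) ∎)

    at-q'+p : suc (A * Q) ≡ (q' + p) * P
    at-q'+p = squeeze (attained (floor q'≤q'+p q'+p≤q'+Q))
                      (attained (floor q'≤q'+Q∸p q'+Q∸p≤q'+Q)) (begin
      suc (A * Q) + suc (B * Q)          ≡⟨ +-both 1 scaled-balance ⟨
      suc (C * Q) + suc (D * Q)          ≡⟨ cong₂ _+_ at-q'+Q at-q' ⟨
      (q' + Q) * P + q' * P              ≡⟨ linear ⟩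
      (q' + p) * P + (q' + (Q ∸ p)) * P  ∎)

  balanced⇒∣-lower : Adjacent P Q p' q' → FloorsOn lower → Q ∣ p
  balanced⇒∣-lower adj floor = Q∣p (proj₁ (adjacent-coprime {P} {Q} {p'} adj)) (suc D) (suc A) (begin
    suc A * Q             ≡⟨ at-q'+p ⟨
    suc ((q' + p) * P)    ≡⟨ cong suc split-p ⟩
    suc (q' * P) + P * p  ≡⟨ cong (_+ P * p) at-q' ⟩
    suc D * Q + P * p     ∎)
    where
    open ≡-Reasoning

    exact : ∀ {i} → q' ≤ i → i ≤ q' + Q → ∀ z → suc (i * P) ≡ z * Q → suc (i * P) ≡ suc (F i) * Q
    exact q'≤i i≤q'+Q z 1+iP≡zQ =
      trans 1+iP≡zQ (cong (_* Q) (sym (IsFloor-lower-exact {z = z} (floor q'≤i i≤q'+Q) 1+iP≡zQ)))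

    at-q' : suc (q' * P) ≡ suc D * Q
    at-q' = exact ≤-refl q'≤q'+Q p'
      (trans (cong suc (*-comm q' P)) (trans (+-comm 1 (P * q')) (sym adj)))

    at-q'+Q : suc ((q' + Q) * P) ≡ suc C * Q
    at-q'+Q = exact q'≤q'+Q ≤-refl (p' + P) (begin
      suc ((q' + Q) * P)   ≡⟨ solve (q' ∷ Q ∷ P ∷ []) ⟩
      P * q' + 1 + P * Q   ≡⟨ cong (_+ P * Q) adj ⟨
      p' * Q + P * Q       ≡⟨ *-distribʳ-+ Q p' P ⟨
      (p' + P) * Q         ∎)

    upper-bound : ∀ {i} → q' ≤ i → i ≤ q' + Q → suc (i * P) ≤ suc (F i) * Q
    upper-bound q'≤i i≤q'+Q = ≰⇒> (maximal (floor q'≤i i≤q'+Q))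

    at-q'+p : suc ((q' + p) * P) ≡ suc A * Q
    at-q'+p = squeeze (upper-bound q'≤q'+p q'+p≤q'+Q)
                      (upper-bound q'≤q'+Q∸p q'+Q∸p≤q'+Q) (begin
      suc ((q' + p) * P) + suc ((q' + (Q ∸ p)) * P) ≡⟨ +-both 1 linear ⟨
      suc ((q' + Q) * P) + suc (q' * P)             ≡⟨ cong₂ _+_ at-q'+Q at-q' ⟩
      suc C * Q + suc D * Q                         ≡⟨ +-both Q scaled-balance ⟩
      suc A * Q + suc B * Q                         ∎)

  balanced⇒∣ : ∀ s → Straddle s p' q' P Q → FloorsOn (opposite s) → Q ∣ p
  balanced⇒∣ upper = balanced⇒∣-lower
  balanced⇒∣ lower = balanced⇒∣-upper

lemma9 : (a : ℕ → ℕ) → (∀ i → 1 ≤ i → 1 ≤ a i) →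
    (t n : ℕ) → 1 ≤ n →
    qq a (suc t) + qq a t ∸ 1 ≤ n → n ≤ qq a (suc (suc t)) + qq a (suc t) ∸ 2 →
    ∀ p → IsPeriod (sturm a) n p → qq a (suc t) ≤ p
lemma9 a a-pos zero    n _ _       _ p (1≤p , _) = 1≤p
lemma9 a a-pos (suc t) n _ n-large _ p period@(1≤p , _) =
  [ id , (λ p≤Q → ∣⇒≤ {{>-nonZero 1≤p}} (short-period⇒∣ p≤Q)) ]′ (≤-total Q p)
  where
  Q q' : ℕ
  Q  = qq a (suc (suc t))
  q' = qq a (suc t)

  instance
    Q≢0 : NonZero Q
    Q≢0 = >-nonZero (qq-pos a a-pos (suc t))

  short-period⇒∣ : p ≤ Q → Q ∣ p
  short-period⇒∣ p≤Q =
    balanced⇒∣ (floorMul a) p≤Q (period-balances a a-pos q' Q (qq-pos a a-pos t) n-large p≤Q period)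
      (side (suc t)) (convergents-straddle a (suc t)) (floorMul-IsFloor-window a a-pos t)
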